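{- Let $A,B\subset\mathbb{R}^2$ be Pareto sets of size $n$ each, sorted lexicographically, let $M_{ij}=A_i+B_j$, and let $R=[x_{\min},x_{\max})\times[y_{\min},y_{\max})$ be a query range. The sweep algorithm returns the lexicographically smallest entry of $M$ lying in $R$ (or reports that none exists), and runs in $\mathcal{O}(n)$ time.
   Context: For $p,p'\in\mathbb{R}^2$, $p$ dominates $p'$ if $p\neq p'$, $p.x\le p'.x$ and $p.y\le p'.y$. A Pareto set is a set $S\subset\mathbb{R}^2$ in which no point dominates another. $A_i$, $B_j$ denote the elements of rank $i$, $j$ in lexicographic order; entries $M_{ij}=A_i+B_j$ are computed on demand. Thus within each column of $M$ (and each row), $x$-coordinates strictly increase and $y$-coordinates strictly decrease with the index. The sweep algorithm: keep a row pointer $i$, initially $i=n$, and a current best candidate $m$ (initially none). For columns $j=1,2,\dots,n$ in turn: if $M_{ij}.x\ge x_{\min}$ and $M_{ij}.y<y_{\max}$, move $i$ upward by linear search to the smallest row index $i'\le i$ such that all of $M_{i'j},\dots,M_{ij}$ satisfy $x\ge x_{\min}$ and $y<y_{\max}$, and set $i=i'$; then, if $M_{ij}\in R$ and ($m$ is undefined or $M_{ij}$ is lexicographically smaller than $m$), set $m=M_{ij}$; then proceed to column $j+1$ with the same row pointer $i$. After the last column, return $m$. -}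

module Defs where

open import Level using (Level; _⊔_)
open import Data.Nat using (ℕ; zero; suc; _∸_)
import Data.Nat as N
open import Data.Product using (_×_; _,_; proj₁; proj₂; Σ; ∃)
open import Data.Sum using (_⊎_)
open import Data.Maybe using (Maybe; just; nothing)
open import Relation.Binary.Bundles using (StrictTotalOrder)
open import Relation.Binary.PropositionalEquality using (_≡_)
open import Relation.Nullary using (¬_; Dec; yes; no)
open import Relation.Nullary.Decidable using (_×-dec_; _⊎-dec_)

-- An ordered "coordinate" domain: a decidable strict total order with an
-- addition that is congruent and strictly monotone in each argument.
-- (ℝ with its usual order and addition is an instance.)
record OrderedAdd (a ℓ₁ ℓ₂ : Level) : Set (Level.suc (a ⊔ ℓ₁ ⊔ ℓ₂)) where
  field
    sto : StrictTotalOrder a ℓ₁ ℓ₂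
  open StrictTotalOrder sto public
  field
    _+_     : Carrier → Carrier → Carrier
    +-cong  : ∀ {a b c d} → a ≈ b → c ≈ d → (a + c) ≈ (b + d)
    +-monoˡ : ∀ {a b} c → a < b → (a + c) < (b + c)
    +-monoʳ : ∀ {a b} c → a < b → (c + a) < (c + b)

module Plane {a ℓ₁ ℓ₂} (S : OrderedAdd a ℓ₁ ℓ₂) where
  open OrderedAdd S

  Pt : Set a
  Pt = Carrier × Carrier

  _⊕_ : Pt → Pt → Pt
  (x , y) ⊕ (x' , y') = (x + x') , (y + y')

  _≤c_ : Carrier → Carrier → Set (ℓ₁ ⊔ ℓ₂)
  u ≤c v = (u < v) ⊎ (u ≈ v)

  _≈p_ : Pt → Pt → Set ℓ₁
  p ≈p q = (proj₁ p ≈ proj₁ q) × (proj₂ p ≈ proj₂ q)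

  Dominates : Pt → Pt → Set (ℓ₁ ⊔ ℓ₂)
  Dominates p q = (¬ (p ≈p q)) × (proj₁ p ≤c proj₁ q) × (proj₂ p ≤c proj₂ q)

  _<lex_ : Pt → Pt → Set (ℓ₁ ⊔ ℓ₂)
  p <lex q = (proj₁ p < proj₁ q) ⊎ ((proj₁ p ≈ proj₁ q) × (proj₂ p < proj₂ q))

  _≤lex_ : Pt → Pt → Set (ℓ₁ ⊔ ℓ₂)
  p ≤lex q = (p <lex q) ⊎ (p ≈p q)

  -- A : ℕ → Pt with the n points A 0 , … , A (n-1) (0-based ranks) forms a
  -- Pareto set of size n sorted lexicographically (strictly, hence distinct)
  SortedPareto : ℕ → (ℕ → Pt) → Set (ℓ₁ ⊔ ℓ₂)
  SortedPareto n A =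
    (∀ i j → i N.< n → j N.< n → ¬ Dominates (A i) (A j)) ×
    (∀ i j → i N.< j → j N.< n → A i <lex A j)

  record Range : Set a where
    constructor range
    field
      xmin xmax ymin ymax : Carrier

  _∈R_ : Pt → Range → Set (ℓ₁ ⊔ ℓ₂)
  p ∈R range xmin xmax ymin ymax =
    (xmin ≤c proj₁ p) × (proj₁ p < xmax) × (ymin ≤c proj₂ p) × (proj₂ p < ymax)

  _≤c?_ : ∀ u v → Dec (u ≤c v)
  u ≤c? v = (u <? v) ⊎-dec (u ≟ v)

  _<lex?_ : ∀ p q → Dec (p <lex q)
  p <lex? q = (proj₁ p <? proj₁ q) ⊎-dec ((proj₁ p ≟ proj₁ q) ×-dec (proj₂ p <? proj₂ q))

  _∈R?_ : ∀ p R → Dec (p ∈R R)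
  p ∈R? range xmin xmax ymin ymax =
    (xmin ≤c? proj₁ p) ×-dec ((proj₁ p <? xmax) ×-dec ((ymin ≤c? proj₂ p) ×-dec (proj₂ p <? ymax)))

  -- The sweep algorithm on the implicit matrix M i j = A i ⊕ B j
  -- (0-based indices; rows/columns 0 … n-1).  Cost model: every
  -- evaluation of an entry of M counts one unit of time.
  module Sweep (A B : ℕ → Pt) (R : Range) where
    open Range R

    M : ℕ → ℕ → Pt
    M i j = A i ⊕ B j

    Cond : Pt → Set (ℓ₁ ⊔ ℓ₂)
    Cond p = (xmin ≤c proj₁ p) × (proj₂ p < ymax)

    cond? : ∀ p → Dec (Cond p)
    cond? p = (xmin ≤c? proj₁ p) ×-dec (proj₂ p <? ymax)

    -- linear search upward from row i (which satisfies Cond) in column j: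
    -- returns the new row and the number of entries evaluated
    climb : ℕ → ℕ → ℕ × ℕ
    climb zero    j = zero , zero
    climb (suc i) j with cond? (M i j)
    ... | yes _ = proj₁ (climb i j) , suc (proj₂ (climb i j))
    ... | no  _ = suc i , 1

    update : Pt → Maybe Pt → Maybe Pt
    update q m with q ∈R? R
    update q nothing  | yes _ = just q
    update q (just p) | yes _ with q <lex? p
    ... | yes _ = just q
    ... | no  _ = just p
    update q m        | no  _ = m

    -- process k columns starting at column j with row pointer i and
    -- candidate m; returns final candidate and cost
    loop : ℕ → ℕ → ℕ → Maybe Pt → Maybe Pt × ℕ
    loop zero    j i m = m , zero
    loop (suc k) j i m with cond? (M i j)
    ... | yes _ = let i' = proj₁ (climb i j)
                      r  = loop k (suc j) i' (update (M i' j) m)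
                  in proj₁ r , suc (proj₂ (climb i j) N.+ proj₂ r)
    ... | no  _ = let r = loop k (suc j) i (update (M i j) m)
                  in proj₁ r , suc (proj₂ r)

    sweep : ℕ → Maybe Pt × ℕ
    sweep n = loop n zero (n ∸ 1) nothing

  LexMinInRange : ℕ → (ℕ → ℕ → Pt) → Range → Maybe Pt → Set (a ⊔ ℓ₁ ⊔ ℓ₂)
  LexMinInRange n M R nothing = Level.Lift a (∀ i j → i N.< n → j N.< n → ¬ (M i j ∈R R))
  LexMinInRange n M R (just p) =
    (∃ λ i → ∃ λ j → (i N.< n) × (j N.< n) × (M i j ≡ p)) ×
    (p ∈R R) ×
    (∀ i j → i N.< n → j N.< n → M i j ∈R R → p ≤lex M i j)

{-# OPTIONS --safe #-}

-- Adding a fixed point preserves the staircase shape of a sorted Pareto set (x strictly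
-- increasing, y strictly decreasing), so every row and every column of M is a staircase.
-- Along a staircase the sweep test (x ≥ xmin, y < ymax) passes on to later entries, and an
-- entry passing the test lies in R as soon as some later entry does.  Hence the first entry
-- of column j passing the test is the lexicographic minimum of that column in R (if the
-- column meets R at all), and its row still passes the test in column j + 1, so the pointer
-- only moves up.  Folding the column minima yields the lexicographic minimum of M in R, and
-- as the pointer climbs at most n − 1 rows in total, at most 2n + (n − 1) ≤ 3n entries are
-- evaluated.
module Submission where

open import Defs
open import Level using (Level; _⊔_; lift)
open import Data.Nat using (ℕ; zero; suc; _+_; _*_; _≤_; _∸_; z≤n; s≤s)
import Data.Nat as ℕ
open import Data.Nat.Properties
  using (≤-refl; ≤-trans; ≤-<-trans; <-trans; <⇒≤; ≰⇒>; n<1+n; n≤1+n; m<n⇒m<1+n;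
         m≤n⇒m<n∨m≡n; m<1+n⇒m<n∨m≡n; <⇒≤pred; m<m+n; m∸n≤m; +-suc; +-identityʳ;
         +-monoʳ-≤; +-monoˡ-≤; +-commutativeSemigroup; module ≤-Reasoning)
open import Data.Nat.Tactic.RingSolver using (solve)
open import Data.List using ([]; _∷_)
open import Data.Product using (Σ; _×_; _,_; proj₁; proj₂; ∃; map)
open import Data.Product.Relation.Binary.Lex.Strict using (×-strictTotalOrder)
open import Data.Sum using (_⊎_; inj₁; inj₂; [_,_]′)
open import Data.Maybe using (Maybe; just; nothing)
open import Function using (id)
open import Relation.Binary.Bundles using (StrictTotalOrder)
open import Relation.Binary.Definitions using (Transitive; Trans; tri<; tri≈; tri>)
import Relation.Binary.Construct.StrictToNonStrict as StrictToNonStrict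
open import Relation.Binary.PropositionalEquality as ≡ using (_≡_; refl)
open import Relation.Nullary using (¬_; yes; no; contradiction)
open import Relation.Unary using (Pred; _∪_; _≐_)

module Orders {a ℓ₁ ℓ₂} (S : OrderedAdd a ℓ₁ ℓ₂) where
  open OrderedAdd S
  open Plane S

  -- _≤c_, _<lex_ and _≤lex_ coincide definitionally with the library's StrictToNonStrict and
  -- ×-Lex constructions, whose properties are reused here.
  private
    module ≤c = StrictToNonStrict _≈_ _<_

  ≤c-trans : Transitive _≤c_
  ≤c-trans = ≤c.trans isEquivalence <-resp-≈ trans

  ≤c-<-trans : Trans _≤c_ _<_ _<_
  ≤c-<-trans = ≤c.≤-<-trans Eq.sym trans <-respˡ-≈

  lexOrder : StrictTotalOrder a ℓ₁ (ℓ₁ ⊔ ℓ₂)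
  lexOrder = ×-strictTotalOrder sto sto

  private
    module Lex = StrictTotalOrder lexOrder
    module ≤lex = StrictToNonStrict Lex._≈_ Lex._<_

  ≤lex-trans : Transitive _≤lex_
  ≤lex-trans = ≤lex.trans Lex.isEquivalence Lex.<-resp-≈ Lex.trans

  <lex-≤lex-trans : Trans _<lex_ _≤lex_ _<lex_
  <lex-≤lex-trans = ≤lex.<-≤-trans Lex.trans (proj₁ Lex.<-resp-≈)

  ≮lex⇒≥lex : ∀ {p q} → ¬ (p <lex q) → q ≤lex p
  ≮lex⇒≥lex {p} {q} p≮q with Lex.compare q p
  ... | tri< q<p _ _ = inj₁ q<p
  ... | tri≈ _ q≈p _ = inj₂ q≈p
  ... | tri> _ _ p<q = contradiction p<q p≮q

module Staircases {a ℓ₁ ℓ₂} (S : OrderedAdd a ℓ₁ ℓ₂) where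
  open OrderedAdd S
  open Plane S
  open Orders S

  _↖_ : Pt → Pt → Set ℓ₂
  p ↖ q = (proj₁ p < proj₁ q) × (proj₂ q < proj₂ p)

  <lex∧¬dominates⇒↖ : ∀ {p q} → p <lex q → ¬ Dominates p q → p ↖ q
  <lex∧¬dominates⇒↖ {p} {q} p<q p⋠q = x< , y>
    where
    x< : proj₁ p < proj₁ q
    x< = [ id , (λ (x≈ , y<) → contradiction (distinct y< , inj₂ x≈ , inj₁ y<) p⋠q) ]′ p<q
      where distinct = λ y< p≈q → irrefl (proj₂ p≈q) y<

    p≉q : ¬ (p ≈p q)
    p≉q p≈q = irrefl (proj₁ p≈q) x<

    y> : proj₂ q < proj₂ p
    y> with compare (proj₂ q) (proj₂ p)
    ... | tri< y> _ _ = y>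
    ... | tri≈ _ y≈ _ = contradiction (p≉q , inj₁ x< , inj₂ (Eq.sym y≈)) p⋠q
    ... | tri> _ _ y< = contradiction (p≉q , inj₁ x< , inj₁ y<) p⋠q

  ⊕-monoˡ-↖ : ∀ {p q} c → p ↖ q → (p ⊕ c) ↖ (q ⊕ c)
  ⊕-monoˡ-↖ c (x< , y>) = +-monoˡ (proj₁ c) x< , +-monoˡ (proj₂ c) y>

  ⊕-monoʳ-↖ : ∀ {p q} c → p ↖ q → (c ⊕ p) ↖ (c ⊕ q)
  ⊕-monoʳ-↖ c (x< , y>) = +-monoʳ (proj₁ c) x< , +-monoʳ (proj₂ c) y>

  Staircase : ℕ → (ℕ → Pt) → Set ℓ₂
  Staircase n Q = ∀ {i i'} → i ℕ.< i' → i' ℕ.< n → Q i ↖ Q i'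

  sortedPareto⇒staircase : ∀ {n Q} → SortedPareto n Q → Staircase n Q
  sortedPareto⇒staircase (undominated , sorted) {i} {i'} i<i' i'<n =
    <lex∧¬dominates⇒↖ (sorted i i' i<i' i'<n) (undominated i i' (<-trans i<i' i'<n) i'<n)

  module _ {n Q} (staircase : Staircase n Q) where

    staircase-≤c : ∀ {i i'} → i ≤ i' → i' ℕ.< n →
                   (proj₁ (Q i) ≤c proj₁ (Q i')) × (proj₂ (Q i') ≤c proj₂ (Q i))
    staircase-≤c i≤i' i'<n with m≤n⇒m<n∨m≡n i≤i'
    ... | inj₁ i<i' = map inj₁ inj₁ (staircase i<i' i'<n)
    ... | inj₂ refl = inj₂ Eq.refl , inj₂ Eq.refl

    staircase-≤lex : ∀ {i i'} → i ≤ i' → i' ℕ.< n → Q i ≤lex Q i'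
    staircase-≤lex i≤i' i'<n with m≤n⇒m<n∨m≡n i≤i'
    ... | inj₁ i<i' = inj₁ (inj₁ (proj₁ (staircase i<i' i'<n)))
    ... | inj₂ refl = inj₂ (Eq.refl , Eq.refl)

module Sweeping {a ℓ₁ ℓ₂} (S : OrderedAdd a ℓ₁ ℓ₂) (R : Plane.Range S) where
  open Plane S
  open Orders S
  open Staircases S

  LexMinIn : ∀ {ℓ} → Pred Pt ℓ → Maybe Pt → Set (a ⊔ ℓ ⊔ ℓ₁ ⊔ ℓ₂)
  LexMinIn P nothing  = ∀ p → P p → ¬ (p ∈R R)
  LexMinIn P (just q) = P q × q ∈R R × (∀ p → P p → p ∈R R → q ≤lex p)

  Representative : ∀ {ℓ} → Pred Pt ℓ → Pt → Set (a ⊔ ℓ ⊔ ℓ₁ ⊔ ℓ₂)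
  Representative Q q = Q q × (∀ p → Q p → p ∈R R → q ∈R R × q ≤lex p)

  LexMinIn-resp-≐ : ∀ {ℓ ℓ'} {P : Pred Pt ℓ} {P' : Pred Pt ℓ'} {m} →
                    P ≐ P' → LexMinIn P m → LexMinIn P' m
  LexMinIn-resp-≐ {m = nothing} (_ , P'⊆P) none = λ p P'p → none p (P'⊆P P'p)
  LexMinIn-resp-≐ {m = just q} (P⊆P' , P'⊆P) (Pq , q∈R , least) =
    P⊆P' Pq , q∈R , λ p P'p → least p (P'⊆P P'p)

  module _ (A B : ℕ → Pt) where
    open Sweep A B R

    update-lexMin : ∀ {ℓ ℓ'} {P : Pred Pt ℓ} {Q : Pred Pt ℓ'} q m →
                    Representative Q q → LexMinIn P m → LexMinIn (P ∪ Q) (update q m)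
    update-lexMin q m (Qq , represents) best with q ∈R? R
    update-lexMin q nothing (Qq , represents) none | yes q∈R =
      inj₂ Qq , q∈R , λ p → [ (λ Pp p∈R → contradiction p∈R (none p Pp)) , q-least p ]′
      where q-least = λ p Qp p∈R → proj₂ (represents p Qp p∈R)
    update-lexMin q (just p) (Qq , represents) (Pp , p∈R , p-least) | yes q∈R with q <lex? p
    ... | yes q<p = inj₂ Qq , q∈R , λ s → [ (λ Ps s∈R → inj₁ (<lex-≤lex-trans q<p (p-least s Ps s∈R)))
                                            , q-least s ]′
      where q-least = λ s Qs s∈R → proj₂ (represents s Qs s∈R)
    ... | no q≮p = inj₁ Pp , p∈R , λ s → [ p-least s
                                         , (λ Qs s∈R → ≤lex-trans (≮lex⇒≥lex q≮p) (proj₂ (represents s Qs s∈R))) ]′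
    update-lexMin q nothing (Qq , represents) none | no q∉R =
      λ s → [ none s , (λ Qs s∈R → q∉R (proj₁ (represents s Qs s∈R))) ]′
    update-lexMin q (just p) (Qq , represents) (Pp , p∈R , p-least) | no q∉R =
      inj₁ Pp , p∈R , λ s → [ p-least s , (λ Qs s∈R → contradiction (proj₁ (represents s Qs s∈R)) q∉R) ]′

    ∈R⇒Cond : ∀ {p} → p ∈R R → Cond p
    ∈R⇒Cond (xmin≤x , _ , _ , y<ymax) = xmin≤x , y<ymax

    module _ {n Q} (staircase : Staircase n Q) {i i'} (i≤i' : i ≤ i') (i'<n : i' ℕ.< n) where
      private
        x≤x' = proj₁ (staircase-≤c staircase i≤i' i'<n)
        y'≤y = proj₂ (staircase-≤c staircase i≤i' i'<n)

      Cond-forward : Cond (Q i) → Cond (Q i')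
      Cond-forward (xmin≤x , y<ymax) = ≤c-trans xmin≤x x≤x' , ≤c-<-trans y'≤y y<ymax

      ∈R-backward : Cond (Q i) → Q i' ∈R R → Q i ∈R R
      ∈R-backward (xmin≤x , y<ymax) (_ , x'<xmax , ymin≤y' , _) =
        xmin≤x , ≤c-<-trans x≤x' x'<xmax , ≤c-trans ymin≤y' y'≤y , y<ymax

    module Correctness (n : ℕ) (A-staircase : Staircase n A) (B-staircase : Staircase n B) where

      column : ∀ j → Staircase n (λ i → M i j)
      column j i<i' i'<n = ⊕-monoˡ-↖ (B j) (A-staircase i<i' i'<n)

      row : ∀ i → Staircase n (M i)
      row i j<j' j'<n = ⊕-monoʳ-↖ (A i) (B-staircase j<j' j'<n)

      InColumn : ℕ → Pred Pt a
      InColumn j p = ∃ λ r → (r ℕ.< n) × (M r j ≡ p)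

      InFirstColumns : ℕ → Pred Pt a
      InFirstColumns j p = ∃ λ r → ∃ λ c → (r ℕ.< n) × (c ℕ.< j) × (M r c ≡ p)

      firstColumns-suc : ∀ {j} → InFirstColumns j ∪ InColumn j ≐ InFirstColumns (suc j)
      firstColumns-suc {j} = merge , split
        where
        merge : ∀ {p} → (InFirstColumns j ∪ InColumn j) p → InFirstColumns (suc j) p
        merge (inj₁ (r , c , r<n , c<j , refl)) = r , c , r<n , m<n⇒m<1+n c<j , refl
        merge (inj₂ (r , r<n , refl)) = r , j , r<n , n<1+n j , refl
        split : ∀ {p} → InFirstColumns (suc j) p → (InFirstColumns j ∪ InColumn j) p
        split (r , c , r<n , c<1+j , refl) with m<1+n⇒m<n∨m≡n c<1+j
        ... | inj₁ c<j = inj₁ (r , c , r<n , c<j , refl)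
        ... | inj₂ refl = inj₂ (r , r<n , refl)

      update-column : ∀ {j q m} → Representative (InColumn j) q → LexMinIn (InFirstColumns j) m →
                      LexMinIn (InFirstColumns (suc j)) (update q m)
      update-column {q = q} {m} represents best =
        LexMinIn-resp-≐ firstColumns-suc (update-lexMin q m represents best)

      climb-Cond : ∀ {j} i → Cond (M i j) → Cond (M (proj₁ (climb i j)) j)
      climb-Cond zero c = c
      climb-Cond {j} (suc i) c with cond? (M i j)
      ... | yes c' = climb-Cond i c'
      ... | no _ = c

      climb-least : ∀ {j} i → i ℕ.< n → ∀ {r} → Cond (M r j) → proj₁ (climb i j) ≤ r
      climb-least zero _ _ = z≤n
      climb-least {j} (suc i) 1+i<n cr with cond? (M i j)
      ... | yes _ = climb-least i (<⇒≤ 1+i<n) cr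
      ... | no ¬c = ≰⇒> (λ r≤i → ¬c (Cond-forward (column j) r≤i (<⇒≤ 1+i<n) cr))

      climb-represents : ∀ {i j} → i ℕ.< n → Cond (M i j) →
                         Representative (InColumn j) (M (proj₁ (climb i j)) j)
      climb-represents {i} {j} i<n c =
        (i' , ≤-<-trans (climb-least i i<n c) i<n , refl) , represents
        where
        i' = proj₁ (climb i j)
        represents : ∀ p → InColumn j p → p ∈R R → M i' j ∈R R × M i' j ≤lex p
        represents _ (r , r<n , refl) r∈R =
          ∈R-backward (column j) i'≤r r<n (climb-Cond i c) r∈R , staircase-≤lex (column j) i'≤r r<n
          where i'≤r = climb-least i i<n (∈R⇒Cond r∈R)

      bottom-represents : ∀ {i j} → i ≡ n ∸ 1 → i ℕ.< n → ¬ Cond (M i j) →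
                          Representative (InColumn j) (M i j)
      bottom-represents {j = j} refl i<n ¬c = (n ∸ 1 , i<n , refl) , represents
        where
        represents : ∀ p → InColumn j p → p ∈R R → M (n ∸ 1) j ∈R R × M (n ∸ 1) j ≤lex p
        represents _ (r , r<n , refl) r∈R =
          contradiction (Cond-forward (column j) (<⇒≤pred r<n) i<n (∈R⇒Cond r∈R)) ¬c

      -- Under this invariant a failed test at the pointer can only occur on the last row, where
      -- it means that the whole column misses R.
      Invariant : ℕ → ℕ → Set (ℓ₁ ⊔ ℓ₂)
      Invariant i j = (i ≡ n ∸ 1) ⊎ (j ℕ.< n → Cond (M i j))

      loop-correct : ∀ k j i m → j + k ≡ n → i ℕ.< n → Invariant i j →
                     LexMinIn (InFirstColumns j) m → LexMinIn (InFirstColumns n) (proj₁ (loop k j i m))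
      loop-correct zero j i m j+0≡n _ _ best =
        ≡.subst (λ c → LexMinIn (InFirstColumns c) m) (≡.trans (≡.sym (+-identityʳ j)) j+0≡n) best
      loop-correct (suc k) j i m j+k≡n i<n inv best with cond? (M i j)
      ... | yes c = loop-correct k (suc j) i' _ (≡.trans (≡.sym (+-suc j k)) j+k≡n)
                      (≤-<-trans (climb-least i i<n c) i<n)
                      (inj₂ (λ 1+j<n → Cond-forward (row i') (n≤1+n j) 1+j<n (climb-Cond i c)))
                      (update-column (climb-represents i<n c) best)
        where i' = proj₁ (climb i j)
      ... | no ¬c = loop-correct k (suc j) i _ (≡.trans (≡.sym (+-suc j k)) j+k≡n) i<n
                      (inj₁ i≡bottom) (update-column (bottom-represents i≡bottom i<n ¬c) best)
        where
        j<n = ≡.subst (j ℕ.<_) j+k≡n (m<m+n j (s≤s z≤n))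
        i≡bottom = [ id , (λ c → contradiction (c j<n) ¬c) ]′ inv

      lexMinInRange : ∀ {m} → LexMinIn (InFirstColumns n) m → LexMinInRange n M R m
      lexMinInRange {nothing} none = lift λ i j i<n j<n → none (M i j) (i , j , i<n , j<n , refl)
      lexMinInRange {just q} (q∈M , q∈R , least) =
        q∈M , q∈R , λ i j i<n j<n → least (M i j) (i , j , i<n , j<n , refl)

    sweep-correct : ∀ n → Staircase n A → Staircase n B → LexMinInRange n M R (proj₁ (sweep n))
    sweep-correct zero _ _ = lift λ _ _ ()
    sweep-correct (suc n) A-staircase B-staircase =
      lexMinInRange (loop-correct (suc n) 0 n nothing refl (n<1+n n) (inj₁ refl) no-columns)
      where
      open Correctness (suc n) A-staircase B-staircase
      no-columns : LexMinIn (InFirstColumns 0) nothing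
      no-columns _ (_ , _ , _ , () , _)

module Cost {a ℓ₁ ℓ₂} (S : OrderedAdd a ℓ₁ ℓ₂) (A B : ℕ → Plane.Pt S) (R : Plane.Range S) where
  open Plane.Sweep S A B R
  open import Algebra.Properties.CommutativeSemigroup +-commutativeSemigroup using (x∙yz≈y∙xz)

  climb-cost : ∀ i j → proj₂ (climb i j) + proj₁ (climb i j) ≤ suc i
  climb-cost zero j = z≤n
  climb-cost (suc i) j with cond? (M i j)
  ... | yes _ = s≤s (climb-cost i j)
  ... | no _ = ≤-refl

  loop-cost : ∀ k j i m → proj₂ (loop k j i m) ≤ k + k + i
  loop-cost zero j i m = z≤n
  loop-cost (suc k) j i m with cond? (M i j)
  ... | yes _ = s≤s (begin
        climbed + rest                ≤⟨ +-monoʳ-≤ climbed (loop-cost k (suc j) i' _) ⟩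
        climbed + (k + k + i')       ≡⟨ x∙yz≈y∙xz climbed (k + k) i' ⟩
        k + k + (climbed + i')       ≤⟨ +-monoʳ-≤ (k + k) (climb-cost i j) ⟩
        k + k + suc i                 ≡⟨ solve (k ∷ i ∷ []) ⟩
        k + suc k + i                 ∎)
    where
    open ≤-Reasoning
    i' = proj₁ (climb i j)
    climbed = proj₂ (climb i j)
    rest = proj₂ (loop k (suc j) i' (update (M i' j) m))
  ... | no _ = s≤s (≤-trans (loop-cost k (suc j) i _) (+-monoˡ-≤ i (+-monoʳ-≤ k (n≤1+n k))))

  sweep-cost : ∀ n → proj₂ (sweep n) ≤ 3 * n
  sweep-cost n = begin
    proj₂ (sweep n)     ≤⟨ loop-cost n 0 (n ∸ 1) nothing ⟩
    n + n + (n ∸ 1)     ≤⟨ +-monoʳ-≤ (n + n) (m∸n≤m n 1) ⟩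
    n + n + n           ≡⟨ solve (n ∷ []) ⟩
    3 * n               ∎
    where open ≤-Reasoning

lemma2 : ∀ {a ℓ₁ ℓ₂ : Level} → Σ ℕ λ c →
    (S : OrderedAdd a ℓ₁ ℓ₂) (n : ℕ) (A B : ℕ → Plane.Pt S) (R : Plane.Range S) →
    Plane.SortedPareto S n A → Plane.SortedPareto S n B →
    Plane.LexMinInRange S n (Plane.Sweep.M S A B R) R (proj₁ (Plane.Sweep.sweep S A B R n))
    × proj₂ (Plane.Sweep.sweep S A B R n) ≤ c * n
lemma2 = 3 , λ S n A B R A-pareto B-pareto →
    Sweeping.sweep-correct S R A B n (sortedPareto⇒staircase S A-pareto) (sortedPareto⇒staircase S B-pareto)
  , Cost.sweep-cost S A B R n
  where open Staircases using (sortedPareto⇒staircase)
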